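{- Let $\Sigma,\Gamma$ be finite alphabets, $w\in\Sigma^{\mathbb{N}}$ an infinite word and $h:\Sigma^*\to\Gamma^*$ an injective morphism. If there exists a nonempty word $x$ such that $x^l$ is a factor of $h(w)$ for every $l\in\mathbb{N}$, then $\mathrm{ACE}(w)=\infty$.
   Context: For a nonempty word $v$ and natural number $p$, $v^{p/|v|}$ is the prefix of length $p$ of $vvv\cdots$. The fractional exponent of a nonempty finite word $u$ is $\mathrm{E}(u)=\sup\{r\in\mathbb{Q}\mid\exists v\ne\varepsilon: u=v^r\}$. For an infinite word $w$, $\mathrm{ACE}(w)=\lim_{N\to\infty}\sup\{\mathrm{E}(u)\mid u\text{ a factor of } w,\ |u|\ge N\}$. Morphisms are extended letterwise to infinite words. -}

module Defs where

open import Data.Nat using (ℕ; zero; suc; _+_; _*_; _<_; _≥_)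
open import Data.Fin using (Fin)
open import Data.List using (List; []; _∷_; _++_; length; take; concatMap)
open import Data.Product using (Σ; ∃; _×_; _,_)
open import Relation.Binary.PropositionalEquality using (_≡_)
open import Relation.Nullary using (¬_)

InfWord : Set → Set
InfWord A = ℕ → A

segment : {A : Set} → InfWord A → ℕ → ℕ → List A
segment w i zero    = []
segment w i (suc n) = w i ∷ segment w (suc i) n

prefix : {A : Set} → InfWord A → ℕ → List A
prefix w n = segment w 0 n

FactorInf : {A : Set} → List A → InfWord A → Set
FactorInf u w = ∃ λ i → u ≡ segment w i (length u)

Factor : {A : Set} → List A → List A → Set
Factor x y = ∃ λ p → ∃ λ s → y ≡ p ++ (x ++ s)

_^ʷ_ : {A : Set} → List A → ℕ → List A
v ^ʷ zero  = []
v ^ʷ suc k = v ++ (v ^ʷ k)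

-- fractional power  v^{p/|v|} : the prefix of length p of v v v ...
-- (for nonempty v, v^p has length ≥ p)
fracPow : {A : Set} → List A → ℕ → List A
fracPow v p = take p (v ^ʷ p)

-- "E(u) > k" for a natural number k: there is a nonempty v with
-- u = v^{|u|/|v|} and |u|/|v| > k  (i.e. |u| > k·|v|).
ExpAbove : {A : Set} → List A → ℕ → Set
ExpAbove u k = Σ _ λ v → ¬ (v ≡ []) × (u ≡ fracPow v (length u)) × (k * length v < length u)

-- ACE(w) = ∞ : for every N, sup{E(u) | u factor of w, |u| ≥ N} = ∞,
-- i.e. for every N and every bound k there is a factor u with |u| ≥ N and E(u) > k.
-- (The limit of the non-increasing sups is ∞ iff every sup is ∞.)
ACEInfinite : {A : Set} → InfWord A → Set
ACEInfinite w = ∀ (N k : ℕ) → Σ _ λ u → FactorInf u w × (length u ≥ N) × ExpAbove u k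

Morphism : Set → Set → Set
Morphism A B = A → List B

apply : {A B : Set} → Morphism A B → List A → List B
apply h u = concatMap h u

InjectiveMorphism : {A B : Set} → Morphism A B → Set
InjectiveMorphism h = ∀ u v → apply h u ≡ apply h v → u ≡ v

-- x is a factor of h(w): since h(w) is the limit of h(prefix w n),
-- this means x is a factor of h(prefix w n) for some n.
FactorOfImage : {A B : Set} → List B → Morphism A B → InfWord A → Set
FactorOfImage x h w = ∃ λ n → Factor x (apply h (prefix w n))

module Submission where

-- Since h(w) contains arbitrarily high powers of x, long stretches of w are mapped by h into the
-- periodic word x^ω.  Tag each letter boundary of such a stretch with the position of its image
-- modulo |x|.  If factors v and U of w start at the same boundary and both end at boundaries with
-- the same tag, their images are powers of one conjugate of x, so h(v) and h(U) commute; by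
-- injectivity v and U commute, whence U is a prefix of v^ω.  The pigeonhole principle yields such
-- v and U with 0 < |v| ≤ |x| and |U| arbitrarily large.

open import Defs
open import Data.Nat using (ℕ)
open import Data.Fin using (Fin)
open import Data.List using (List; [])
open import Data.Product using (Σ; _×_)
open import Relation.Binary.PropositionalEquality using (_≡_)
open import Relation.Nullary using (¬_)

open import Data.Nat.Base using (zero; suc; _+_; _*_; _∸_; _≤_; _<_; _≥_; z≤n; s≤s; s≤s⁻¹; NonZero; >-nonZero⁻¹)
open import Data.Nat.Properties
open import Data.Nat.DivMod using (_%_; _mod_; m%n<n; n%n≡0; m<n⇒m%n≡m; %-distribˡ-+)
open import Data.Fin.Base using (toℕ; zero; suc)
open import Data.Fin.Properties using (toℕ-injective; toℕ-fromℕ<; fromℕ<-cong; toℕ<n; pigeonhole)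
open import Data.List.Base using (_∷_; _++_; length; take; lookup; map; allFin)
open import Data.List.Properties using (length-++; ++-assoc; ++-cancelˡ; ∷-injective; concatMap-++)
open import Data.Product.Base using (∃; ∃₂; _,_; proj₁; proj₂)
open import Data.Empty using (⊥-elim)
open import Relation.Binary.PropositionalEquality using (refl; sym; trans; cong; cong₂; subst; subst₂; module ≡-Reasoning)
open import Relation.Nullary using (yes; no)
open import Function.Base using (_∘_)
open import Data.List.Extrema.Nat using (max; xs≤max)
open import Data.List.Relation.Unary.All as All using ()
open import Data.List.Membership.Propositional.Properties using (∈-map⁺; ∈-allFin)

module _ {A : Set} where

  ++-injective : ∀ (xs ys : List A) {zs ws : List A} →
                 length xs ≡ length ys → xs ++ zs ≡ ys ++ ws → xs ≡ ys × zs ≡ ws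
  ++-injective []       []       _   eq = refl , eq
  ++-injective (x ∷ xs) (y ∷ ys) len eq =
    let (x≡y , eq′) = ∷-injective eq
        (xs≡ys , zs≡ws) = ++-injective xs ys (suc-injective len) eq′
    in cong₂ _∷_ x≡y xs≡ys , zs≡ws

  ++-prefix : ∀ (xs ys : List A) {zs ws : List A} →
              length xs ≤ length ys → xs ++ zs ≡ ys ++ ws → ∃ λ r → ys ≡ xs ++ r
  ++-prefix []       ys       _         _  = ys , refl
  ++-prefix (x ∷ xs) (y ∷ ys) (s≤s len) eq =
    let (x≡y , eq′) = ∷-injective eq
        (r , ys≡xs++r) = ++-prefix xs ys len eq′
    in r , cong₂ _∷_ (sym x≡y) ys≡xs++r

  take-length-++ : ∀ (xs ys : List A) → take (length xs) (xs ++ ys) ≡ xs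
  take-length-++ []       ys = refl
  take-length-++ (x ∷ xs) ys = cong (x ∷_) (take-length-++ xs ys)

  take-length+-++ : ∀ (xs ys : List A) n → take (length xs + n) (xs ++ ys) ≡ xs ++ take n ys
  take-length+-++ []       ys n = refl
  take-length+-++ (x ∷ xs) ys n = cong (x ∷_) (take-length+-++ xs ys n)

  commute⇒prefix-power : ∀ n (v u : List A) → length u ≤ n * length v →
                         v ++ u ≡ u ++ v → u ≡ take (length u) (v ^ʷ n)
  commute⇒prefix-power zero    v []      _     _    = refl
  commute⇒prefix-power (suc n) v u       bound comm with length v ≤? length u
  ... | yes v≤u with ++-prefix v u v≤u comm
  ...   | r , refl = begin
    v ++ r                                   ≡⟨ cong (v ++_) (commute⇒prefix-power n v r bound′ comm′) ⟩
    v ++ take (length r) (v ^ʷ n)            ≡⟨ take-length+-++ v (v ^ʷ n) (length r) ⟨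
    take (length v + length r) (v ^ʷ suc n)  ≡⟨ cong (λ m → take m (v ^ʷ suc n)) (length-++ v) ⟨
    take (length (v ++ r)) (v ^ʷ suc n)      ∎
    where
    open ≡-Reasoning
    comm′ : v ++ r ≡ r ++ v
    comm′ = ++-cancelˡ v _ _ (trans comm (++-assoc v r v))
    bound′ : length r ≤ n * length v
    bound′ = +-cancelˡ-≤ (length v) _ _ (subst (_≤ length v + n * length v) (length-++ v) bound)
  commute⇒prefix-power (suc n) v u bound comm | no v≰u
    with ++-prefix u v (<⇒≤ (≰⇒> v≰u)) (sym comm)
  ... | r , refl = begin
    u                                                ≡⟨ take-length-++ u (r ++ (u ++ r) ^ʷ n) ⟨
    take (length u) (u ++ (r ++ (u ++ r) ^ʷ n))      ≡⟨ cong (take (length u)) (++-assoc u r _) ⟨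
    take (length u) ((u ++ r) ++ (u ++ r) ^ʷ n)      ∎
    where open ≡-Reasoning

  commute⇒fracPow : ∀ (v u : List A) → ¬ (v ≡ []) → v ++ u ≡ u ++ v → u ≡ fracPow v (length u)
  commute⇒fracPow []        u v≢[] _    = ⊥-elim (v≢[] refl)
  commute⇒fracPow v@(_ ∷ _) u _    comm =
    commute⇒prefix-power (length u) v u (m≤m*n (length u) (length v)) comm

module _ {A : Set} where

  length-segment : ∀ (f : InfWord A) i n → length (segment f i n) ≡ n
  length-segment f i zero    = refl
  length-segment f i (suc n) = cong suc (length-segment f (suc i) n)

  segment-++ : ∀ (f : InfWord A) i m n → segment f i (m + n) ≡ segment f i m ++ segment f (i + m) n
  segment-++ f i zero    n = cong (λ j → segment f j n) (sym (+-identityʳ i))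
  segment-++ f i (suc m) n =
    cong (f i ∷_) (trans (segment-++ f (suc i) m n) (cong (λ j → segment f (suc i) m ++ segment f j n) (sym (+-suc i m))))

  segment-cong : ∀ {f g : InfWord A} {i j} → (∀ t → f (i + t) ≡ g (j + t)) →
                 ∀ n → segment f i n ≡ segment g j n
  segment-cong                     eq zero    = refl
  segment-cong {f} {g} {i} {j} eq (suc n) =
    cong₂ _∷_ (trans (cong f (sym (+-identityʳ i))) (trans (eq 0) (cong g (+-identityʳ j))))
              (segment-cong (λ t → trans (cong f (sym (+-suc i t))) (trans (eq (suc t)) (cong g (+-suc j t)))) n)

  segment-lookup : ∀ (f : InfWord A) i (xs : List A) →
                   (∀ k → f (i + toℕ k) ≡ lookup xs k) → segment f i (length xs) ≡ xs
  segment-lookup f i []       _  = refl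
  segment-lookup f i (x ∷ xs) eq =
    cong₂ _∷_ (trans (cong f (sym (+-identityʳ i))) (eq zero))
              (segment-lookup f (suc i) xs (λ k → trans (cong f (sym (+-suc i (toℕ k)))) (eq (suc k))))

  segment-++⁻¹ : ∀ (f : InfWord A) i {n} (xs ys : List A) → xs ++ ys ≡ segment f i n →
                 xs ≡ segment f i (length xs) × ys ≡ segment f (i + length xs) (length ys)
  segment-++⁻¹ f i {n} xs ys eq = ++-injective xs _ (sym (length-segment f i (length xs))) eq′
    where
    n≡ : n ≡ length xs + length ys
    n≡ = trans (sym (length-segment f i n)) (trans (cong length (sym eq)) (length-++ xs))
    eq′ : xs ++ ys ≡ segment f i (length xs) ++ segment f (i + length xs) (length ys)
    eq′ = trans eq (trans (cong (segment f i) n≡) (segment-++ f i (length xs) (length ys)))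

  segment-within : ∀ (f : InfWord A) {pre suf xs ys zs : List A} {n c} →
                   pre ++ (segment f 0 n ++ suf) ≡ xs ++ (ys ++ zs) →
                   length xs ≡ length pre + c → c + length ys ≤ n → ys ≡ segment f c (length ys)
  segment-within f {pre} {suf} {xs} {ys} {zs} {n} {c} eq len bound =
    sym (proj₁ (++-injective (segment f c (length ys)) ys (length-segment f c _)
                             (proj₂ (++-injective (pre ++ segment f 0 c) xs len′ eq′))))
    where
    open ≡-Reasoning
    e = n ∸ (c + length ys)
    n≡ : n ≡ c + (length ys + e)
    n≡ = trans (sym (m+[n∸m]≡n bound)) (+-assoc c (length ys) e)
    len′ : length (pre ++ segment f 0 c) ≡ length xs
    len′ = trans (length-++ pre) (trans (cong (length pre +_) (length-segment f 0 c)) (sym len))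
    eq′ : (pre ++ segment f 0 c) ++ (segment f c (length ys) ++ (segment f (c + length ys) e ++ suf)) ≡ xs ++ (ys ++ zs)
    eq′ = begin
      (pre ++ segment f 0 c) ++ (segment f c (length ys) ++ (segment f (c + length ys) e ++ suf))
        ≡⟨ ++-assoc pre _ _ ⟩
      pre ++ (segment f 0 c ++ (segment f c (length ys) ++ (segment f (c + length ys) e ++ suf)))
        ≡⟨ cong (λ zs → pre ++ (segment f 0 c ++ zs)) (++-assoc (segment f c (length ys)) _ suf) ⟨
      pre ++ (segment f 0 c ++ ((segment f c (length ys) ++ segment f (c + length ys) e) ++ suf))
        ≡⟨ cong (λ zs → pre ++ (segment f 0 c ++ (zs ++ suf))) (segment-++ f c (length ys) e) ⟨
      pre ++ (segment f 0 c ++ (segment f c (length ys + e) ++ suf))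
        ≡⟨ cong (pre ++_) (++-assoc (segment f 0 c) _ suf) ⟨
      pre ++ ((segment f 0 c ++ segment f c (length ys + e)) ++ suf)
        ≡⟨ cong (λ zs → pre ++ (zs ++ suf)) (segment-++ f 0 c (length ys + e)) ⟨
      pre ++ (segment f 0 (c + (length ys + e)) ++ suf)
        ≡⟨ cong (λ m → pre ++ (segment f 0 m ++ suf)) n≡ ⟨
      pre ++ (segment f 0 n ++ suf)
        ≡⟨ eq ⟩
      xs ++ (ys ++ zs) ∎

+-congʳ-mod : ∀ {p} .{{_ : NonZero p}} {c c′} t → c mod p ≡ c′ mod p → (c + t) mod p ≡ (c′ + t) mod p
+-congʳ-mod {p} {c} {c′} t eq = fromℕ<-cong _ _ %-eq (m%n<n (c + t) p) (m%n<n (c′ + t) p)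
  where
  c%≡c′% : c % p ≡ c′ % p
  c%≡c′% = trans (sym (toℕ-fromℕ< (m%n<n c p))) (trans (cong toℕ eq) (toℕ-fromℕ< (m%n<n c′ p)))
  %-eq : (c + t) % p ≡ (c′ + t) % p
  %-eq = trans (%-distribˡ-+ c t p) (trans (cong (λ r → (r + t % p) % p) c%≡c′%) (sym (%-distribˡ-+ c′ t p)))

module _ {A : Set} (x : List A) {{_ : NonZero (length x)}} where

  cycle : InfWord A
  cycle t = lookup x (t mod length x)

  segment-cycle-cong : ∀ {c c′} → c mod length x ≡ c′ mod length x → ∀ n → segment cycle c n ≡ segment cycle c′ n
  segment-cycle-cong eq = segment-cong (λ t → cong (lookup x) (+-congʳ-mod t eq))

  power≡segment-cycle : ∀ l → x ^ʷ l ≡ segment cycle 0 (l * length x)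
  power≡segment-cycle zero    = refl
  power≡segment-cycle (suc l) = begin
    x ++ x ^ʷ l                                                ≡⟨ cong₂ _++_ (sym first-period) (power≡segment-cycle l) ⟩
    segment cycle 0 (length x) ++ segment cycle 0 (l * length x) ≡⟨ cong (segment cycle 0 (length x) ++_) (segment-cycle-cong period _) ⟨
    segment cycle 0 (length x) ++ segment cycle (length x) (l * length x) ≡⟨ segment-++ cycle 0 (length x) (l * length x) ⟨
    segment cycle 0 (length x + l * length x)                  ∎
    where
    open ≡-Reasoning
    first-period : segment cycle 0 (length x) ≡ x
    first-period = segment-lookup cycle 0 x (λ k → cong (lookup x)
      (toℕ-injective (trans (toℕ-fromℕ< (m%n<n (toℕ k) (length x))) (m<n⇒m%n≡m (toℕ<n k)))))
    period : length x mod length x ≡ 0 mod length x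
    period = fromℕ<-cong _ _ (trans (n%n≡0 (length x)) (sym (m<n⇒m%n≡m (>-nonZero⁻¹ (length x))))) _ _

  segment-cycle-comm : ∀ c m n → (c + m) mod length x ≡ c mod length x → (c + n) mod length x ≡ c mod length x →
                       segment cycle c m ++ segment cycle c n ≡ segment cycle c n ++ segment cycle c m
  segment-cycle-comm c m n c+m≡c c+n≡c = begin
    segment cycle c m ++ segment cycle c n       ≡⟨ cong (segment cycle c m ++_) (segment-cycle-cong c+m≡c n) ⟨
    segment cycle c m ++ segment cycle (c + m) n ≡⟨ segment-++ cycle c m n ⟨
    segment cycle c (m + n)                      ≡⟨ cong (segment cycle c) (+-comm m n) ⟩
    segment cycle c (n + m)                      ≡⟨ segment-++ cycle c n m ⟩
    segment cycle c n ++ segment cycle (c + n) m ≡⟨ cong (segment cycle c n ++_) (segment-cycle-cong c+n≡c m) ⟩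
    segment cycle c n ++ segment cycle c m       ∎
    where open ≡-Reasoning

CloseRepetition : ∀ {p} → (ℕ → Fin p) → ℕ → Set
CloseRepetition {p} ρ b = ∃₂ λ s d → b ≤ s × s + d ≤ b + p × 0 < d × ρ s ≡ ρ (s + d)

close-repetition : ∀ {p} (ρ : ℕ → Fin p) b → CloseRepetition ρ b
close-repetition {p} ρ b with pigeonhole (n<1+n p) (λ k → ρ (b + toℕ k))
... | i , j , i<j , ρi≡ρj = b + toℕ i , toℕ j ∸ toℕ i , m≤m+n b (toℕ i) , within , m<n⇒0<n∸m i<j ,
                             trans ρi≡ρj (cong ρ j≡)
  where
  j≡ : b + toℕ j ≡ b + toℕ i + (toℕ j ∸ toℕ i)
  j≡ = trans (cong (b +_) (sym (m+[n∸m]≡n (<⇒≤ i<j)))) (sym (+-assoc b (toℕ i) _))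
  within : b + toℕ i + (toℕ j ∸ toℕ i) ≤ b + p
  within = subst (_≤ b + p) j≡ (+-monoʳ-≤ b (s≤s⁻¹ (toℕ<n j)))

record Recurrence {p} (ρ : ℕ → Fin p) (gap bound : ℕ) : Set where
  field
    start short long : ℕ
    0<short          : 0 < short
    short≤p          : short ≤ p
    gap≤long         : gap ≤ long
    short-in-bound   : start + short ≤ bound
    long-in-bound    : start + long ≤ bound
    ρ-short          : ρ start ≡ ρ (start + short)
    ρ-long           : ρ start ≡ ρ (start + long)

close-repetitions⇒recurrence : ∀ {p} (ρ : ℕ → Fin p) {gap bound b₁ b₂} →
  b₁ + (p + gap) ≤ b₂ → b₂ + p ≤ bound → (r₁ : CloseRepetition ρ b₁) (r₂ : CloseRepetition ρ b₂) →
  ρ (proj₁ r₁) ≡ ρ (proj₁ r₂) → Recurrence ρ gap bound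
close-repetitions⇒recurrence {p} ρ {gap} {bound} {b₁} {b₂} b₁+p+gap≤b₂ b₂+p≤bound
  (s₁ , d₁ , b₁≤s₁ , s₁+d₁≤b₁+p , 0<d₁ , ρ-d₁) (s₂ , d₂ , b₂≤s₂ , s₂+d₂≤b₂+p , _ , _) ρ≡ =
  record
    { start          = s₁
    ; short          = d₁
    ; long           = s₂ ∸ s₁
    ; 0<short        = 0<d₁
    ; short≤p        = +-cancelˡ-≤ b₁ d₁ p (≤-trans (+-monoˡ-≤ d₁ b₁≤s₁) s₁+d₁≤b₁+p)
    ; gap≤long       = +-cancelˡ-≤ s₁ gap _ (subst (s₁ + gap ≤_) (sym s₁+long≡s₂) s₁+gap≤s₂)
    ; short-in-bound = ≤-trans s₁+d₁≤b₁+p (≤-trans (+-monoˡ-≤ p b₁≤b₂) b₂+p≤bound)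
    ; long-in-bound  = subst (_≤ bound) (sym s₁+long≡s₂) (≤-trans (m≤m+n s₂ d₂) (≤-trans s₂+d₂≤b₂+p b₂+p≤bound))
    ; ρ-short        = ρ-d₁
    ; ρ-long         = trans ρ≡ (cong ρ (sym s₁+long≡s₂))
    }
  where
  b₁≤b₂ : b₁ ≤ b₂
  b₁≤b₂ = m+n≤o⇒m≤o b₁ b₁+p+gap≤b₂
  s₁+gap≤s₂ : s₁ + gap ≤ s₂
  s₁+gap≤s₂ = ≤-trans (+-monoˡ-≤ gap (≤-trans (m≤m+n s₁ d₁) s₁+d₁≤b₁+p))
                      (subst (_≤ s₂) (sym (+-assoc b₁ p gap)) (≤-trans b₁+p+gap≤b₂ b₂≤s₂))
  s₁+long≡s₂ : s₁ + (s₂ ∸ s₁) ≡ s₂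
  s₁+long≡s₂ = m+[n∸m]≡n (m+n≤o⇒m≤o s₁ s₁+gap≤s₂)

-- Blocks of length p + gap start at j (p + gap) for j ≤ p; the pigeonhole principle applies to the
-- residues at the starts of the close repetitions found in the p + 1 blocks.
recurrence : ∀ {p} (ρ : ℕ → Fin p) gap → Recurrence ρ gap (suc p * (p + gap))
recurrence {p} ρ gap =
  let (j₁ , j₂ , j₁<j₂ , ρ≡) = pigeonhole (n<1+n p) (λ j → ρ (proj₁ (block j)))
  in close-repetitions⇒recurrence ρ (blocks-apart j₁<j₂) (block-in-bound (s≤s⁻¹ (toℕ<n j₂))) (block j₁) (block j₂) ρ≡
  where
  M = p + gap
  block : (j : Fin (suc p)) → CloseRepetition ρ (toℕ j * M)
  block j = close-repetition ρ (toℕ j * M)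
  blocks-apart : ∀ {i j} → i < j → i * M + M ≤ j * M
  blocks-apart {i} {j} i<j = subst (_≤ j * M) (+-comm M (i * M)) (*-monoˡ-≤ M i<j)
  block-in-bound : ∀ {j} → j ≤ p → j * M + p ≤ suc p * M
  block-in-bound {j} j≤p = subst (j * M + p ≤_) (+-comm (p * M) M) (+-mono-≤ (*-monoˡ-≤ M j≤p) (m≤m+n p gap))

crossing : ∀ (f : ℕ → ℕ) {L a} → f 0 ≡ 0 → (∀ n → f (suc n) ≤ f n + L) →
           ∀ n → a ≤ f n → ∃ λ i → i ≤ n × a ≤ f i × f i ≤ a + L
crossing f     f0≡0 step zero    a≤f0 = 0 , z≤n , a≤f0 , subst (_≤ _) (sym f0≡0) z≤n
crossing f {L} {a} f0≡0 step (suc n) a≤fn+1 with a ≤? f n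
... | yes a≤fn = let (i , i≤n , bounds) = crossing f f0≡0 step n a≤fn in i , m≤n⇒m≤1+n i≤n , bounds
... | no  a≰fn = suc n , ≤-refl , a≤fn+1 , ≤-trans (step n) (+-monoˡ-≤ L (<⇒≤ (≰⇒> a≰fn)))

module _ {A B : Set} (h : Morphism A B) where

  apply-segment-++ : ∀ (w : InfWord A) i m n →
                     apply h (segment w i (m + n)) ≡ apply h (segment w i m) ++ apply h (segment w (i + m) n)
  apply-segment-++ w i m n = trans (cong (apply h) (segment-++ w i m n)) (concatMap-++ h (segment w i m) _)

  length-apply-segment≤ : ∀ {L} → (∀ a → length (h a) ≤ L) → ∀ (w : InfWord A) i n →
                          length (apply h (segment w i n)) ≤ n * L
  length-apply-segment≤ bounded w i zero    = z≤n
  length-apply-segment≤ bounded w i (suc n) =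
    subst (_≤ _) (sym (length-++ (h (w i))))
          (+-mono-≤ (bounded (w i)) (length-apply-segment≤ bounded w (suc i) n))

  ImageOccurs : InfWord A → InfWord B → (i d c : ℕ) → Set
  ImageOccurs w f i d c = apply h (segment w i d) ≡ segment f c (length (apply h (segment w i d)))

  image-occurs-inner : ∀ {w f i d c} s n → s + n ≤ d → ImageOccurs w f i d c →
                       ImageOccurs w f (i + s) n (c + length (apply h (segment w i s)))
  image-occurs-inner {w} {f} {i} {d} {c} s n s+n≤d occ =
    proj₁ (segment-++⁻¹ f (c + length (apply h (segment w i s))) _ _
      (proj₂ (segment-++⁻¹ f c (apply h (segment w i s)) _ (trans (sym split) occ′))))
    where
    e = d ∸ (s + n)
    d≡ : d ≡ s + (n + e)
    d≡ = trans (sym (m+[n∸m]≡n s+n≤d)) (+-assoc s n e)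
    occ′ : apply h (segment w i (s + (n + e))) ≡ segment f c _
    occ′ = subst (λ d → ImageOccurs w f i d c) d≡ occ
    split : apply h (segment w i (s + (n + e))) ≡
            apply h (segment w i s) ++ (apply h (segment w (i + s) n) ++ apply h (segment w (i + s + n) e))
    split = trans (apply-segment-++ w i s (n + e)) (cong (apply h (segment w i s) ++_) (apply-segment-++ w (i + s) n e))

  -- The bound of `recurrence` for p = |x| and gap k p + N + 1, which makes the long factor
  -- longer than N and than k times the short one.
  stretch : (p N k : ℕ) → ℕ
  stretch p N k = suc p * (p + suc (k * p + N))

  occurrence⇒ExpAbove : InjectiveMorphism h → (x : List B) {{_ : NonZero (length x)}} →
    ∀ {w i c} N k → ImageOccurs w (cycle x) i (stretch (length x) N k) c →
    Σ (List A) λ u → FactorInf u w × length u ≥ N × ExpAbove u k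
  occurrence⇒ExpAbove inj x {w} {i} {c} N k occ =
    U , (i + start , cong (segment w (i + start)) (sym (length-segment w _ long))) , N≤|U| ,
    v , v≢[] , commute⇒fracPow v U v≢[] (inj _ _ image-comm) , k|v|<|U|
    where
    p = length x
    G : ℕ → List B
    G j = apply h (segment w i j)
    ρ : ℕ → Fin p
    ρ j = (c + length (G j)) mod p
    open Recurrence (recurrence ρ (suc (k * p + N)))
    c′ = c + length (G start)
    v U : List A
    v = segment w (i + start) short
    U = segment w (i + start) long
    residue : ∀ n → (c′ + length (apply h (segment w (i + start) n))) mod p ≡ ρ (start + n)
    residue n = cong (_mod p) (trans (+-assoc c _ _)
      (cong (c +_) (sym (trans (cong length (apply-segment-++ w i start n)) (length-++ (G start))))))
    occ-v : ImageOccurs w (cycle x) (i + start) short c′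
    occ-v = image-occurs-inner start short short-in-bound occ
    occ-U : ImageOccurs w (cycle x) (i + start) long c′
    occ-U = image-occurs-inner start long long-in-bound occ
    image-comm : apply h (v ++ U) ≡ apply h (U ++ v)
    image-comm = begin
      apply h (v ++ U)
        ≡⟨ concatMap-++ h v U ⟩
      apply h v ++ apply h U
        ≡⟨ cong₂ _++_ occ-v occ-U ⟩
      segment (cycle x) c′ (length (apply h v)) ++ segment (cycle x) c′ (length (apply h U))
        ≡⟨ segment-cycle-comm x c′ _ _ (trans (residue short) (sym ρ-short)) (trans (residue long) (sym ρ-long)) ⟩
      segment (cycle x) c′ (length (apply h U)) ++ segment (cycle x) c′ (length (apply h v))
        ≡⟨ cong₂ _++_ occ-U occ-v ⟨
      apply h U ++ apply h v
        ≡⟨ concatMap-++ h U v ⟨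
      apply h (U ++ v) ∎
      where open ≡-Reasoning
    v≢[] : ¬ (v ≡ [])
    v≢[] v≡[] with () ← subst (0 <_) (trans (sym (length-segment w _ short)) (cong length v≡[])) 0<short
    N≤|U| : length U ≥ N
    N≤|U| = subst (N ≤_) (sym (length-segment w _ long)) (≤-trans (m≤n+m N (k * p)) (≤-trans (n≤1+n _) gap≤long))
    k|v|<|U| : k * length v < length U
    k|v|<|U| = subst₂ (λ a b → k * a < b) (sym (length-segment w _ short)) (sym (length-segment w _ long))
      (≤-trans (s≤s (≤-trans (*-monoʳ-≤ k short≤p) (m≤m+n (k * p) N))) gap≤long)

  -- Extend the occurrence of x^{(D+1)L} by D letters of w and start at the first letter whose image
  -- begins inside it, at most L symbols in: then D more letters fit into the occurrence.
  power-factor⇒image-occurs : ∀ {L} → (∀ a → length (h a) ≤ L) → (x : List B) {{_ : NonZero (length x)}} →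
    ∀ {w} D → FactorOfImage (x ^ʷ (suc D * L)) h w → ∃₂ λ i c → ImageOccurs w (cycle x) i D c
  power-factor⇒image-occurs {L} bounded x {w} D (n , pre , suf , eq) =
    i , P i ∸ a , segment-within (cycle x) {pre} {suf ++ apply h (segment w n D)} {apply h (prefix w i)} (trans (sym extended) split) (sym (m+[n∸m]≡n a≤Pi)) within
    where
    P : ℕ → ℕ
    P j = length (apply h (prefix w j))
    a = length pre
    l = suc D * L
    step : ∀ j → P (suc j) ≤ P j + L
    step j = begin
      P (suc j)                               ≡⟨ cong P (+-comm 1 j) ⟩
      P (j + 1)                               ≡⟨ cong length (apply-segment-++ w 0 j 1) ⟩
      length (apply h (prefix w j) ++ apply h (segment w j 1)) ≡⟨ length-++ (apply h (prefix w j)) ⟩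
      P j + length (apply h (segment w j 1))  ≤⟨ +-monoʳ-≤ (P j) (length-apply-segment≤ bounded w j 1) ⟩
      P j + 1 * L                             ≡⟨ cong (P j +_) (*-identityˡ L) ⟩
      P j + L                                 ∎
      where open ≤-Reasoning
    a≤Pn : a ≤ P n
    a≤Pn = subst (a ≤_) (sym (trans (cong length eq) (length-++ pre))) (m≤m+n a _)
    crossed = crossing P refl step n a≤Pn
    i = proj₁ crossed
    i≤n = proj₁ (proj₂ crossed)
    a≤Pi = proj₁ (proj₂ (proj₂ crossed))
    Pi≤a+L = proj₂ (proj₂ (proj₂ crossed))
    extended : apply h (prefix w (n + D)) ≡
               pre ++ (segment (cycle x) 0 (l * length x) ++ (suf ++ apply h (segment w n D)))
    extended = begin
      apply h (prefix w (n + D))                                ≡⟨ apply-segment-++ w 0 n D ⟩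
      apply h (prefix w n) ++ apply h (segment w n D)            ≡⟨ cong (_++ _) eq ⟩
      (pre ++ (x ^ʷ l ++ suf)) ++ apply h (segment w n D)        ≡⟨ ++-assoc pre _ _ ⟩
      pre ++ ((x ^ʷ l ++ suf) ++ apply h (segment w n D))        ≡⟨ cong (pre ++_) (++-assoc (x ^ʷ l) suf _) ⟩
      pre ++ (x ^ʷ l ++ (suf ++ apply h (segment w n D)))        ≡⟨ cong (λ X → pre ++ (X ++ _)) (power≡segment-cycle x l) ⟩
      pre ++ (segment (cycle x) 0 (l * length x) ++ (suf ++ apply h (segment w n D))) ∎
      where open ≡-Reasoning
    e = n ∸ i
    n+D≡ : n + D ≡ i + (D + e)
    n+D≡ = trans (cong (_+ D) (sym (m+[n∸m]≡n i≤n))) (trans (+-assoc i e D) (cong (i +_) (+-comm e D)))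
    split : apply h (prefix w (n + D)) ≡
            apply h (prefix w i) ++ (apply h (segment w i D) ++ apply h (segment w (i + D) e))
    split = trans (cong (λ m → apply h (prefix w m)) n+D≡)
                  (trans (apply-segment-++ w 0 i (D + e)) (cong (apply h (prefix w i) ++_) (apply-segment-++ w i D e)))
    within : P i ∸ a + length (apply h (segment w i D)) ≤ l * length x
    within = ≤-trans (+-mono-≤ (m≤n+o⇒m∸n≤o (P i) a Pi≤a+L) (length-apply-segment≤ bounded w i D))
                     (m≤m*n l (length x))

  power-factors⇒ACEInfinite : InjectiveMorphism h → ∀ {L} → (∀ a → length (h a) ≤ L) →
    (x : List B) {{_ : NonZero (length x)}} → ∀ {w} → (∀ l → FactorOfImage (x ^ʷ l) h w) → ACEInfinite w
  power-factors⇒ACEInfinite inj {L} bounded x factors N k =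
    let D = stretch (length x) N k
        (i , c , occ) = power-factor⇒image-occurs bounded x D (factors (suc D * L))
    in occurrence⇒ExpAbove inj x N k occ

finite-morphism-bounded : ∀ {m} {B : Set} (h : Morphism (Fin m) B) → ∃ λ L → ∀ a → length (h a) ≤ L
finite-morphism-bounded {m} h = max 0 lengths , λ a → All.lookup (xs≤max 0 lengths) (∈-map⁺ (length ∘ h) (∈-allFin a))
  where
  lengths = map (length ∘ h) (allFin m)

mainTheorem17 : (m n : ℕ) (w : InfWord (Fin m)) (h : Morphism (Fin m) (Fin n)) →
    InjectiveMorphism h →
    (Σ (List (Fin n)) λ x → ¬ (x ≡ []) × (∀ (l : ℕ) → FactorOfImage (x ^ʷ l) h w)) →
    ACEInfinite w
mainTheorem17 m n w h inj ([]          , x≢[] , _)       = ⊥-elim (x≢[] refl)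
mainTheorem17 m n w h inj (x@(_ ∷ _)   , _    , factors) =
  power-factors⇒ACEInfinite h inj (proj₂ (finite-morphism-bounded h)) x factors
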